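{- Let $\Sigma$ be a monoidal signature. If $m\to F\leftarrow n$ and $n\to G\leftarrow p$ are partial monogamous cospans in $\mathrm{Csp}_D(\mathbf{Hyp}_\Sigma)$, then their composite $(m\to F\leftarrow n);(n\to G\leftarrow p)$ is partial monogamous.
   Context: A monoidal signature $\Sigma$ is a set of generators each with an arity and coarity in $\mathbb{N}$. A hypergraph $F$ has a set $F_\star$ of vertices and sets $F_{k,l}$ of hyperedges with ordered source maps $s_i$ ($i<k$) and target maps $t_j$ ($j<l$) into $F_\star$; $\mathbf{Hyp}_\Sigma$ is the category of hypergraphs whose hyperedges in $F_{k,l}$ are labelled by generators of arity $k$ and coarity $l$, with structure-preserving morphisms. The discrete hypergraph $n$ has $n$ vertices and no hyperedges. $\mathrm{Csp}_D(\mathbf{Hyp}_\Sigma)$ is the PROP whose morphisms $m\to n$ are isomorphism classes of cospans $m\to F\leftarrow n$ in $\mathbf{Hyp}_\Sigma$; composition of $m\to F\leftarrow n$ and $n\to G\leftarrow p$ is $m\to F+_n G\leftarrow p$ via pushout. The degree of a vertex $v$ is $(\mathrm{in},\mathrm{out})$ with $\mathrm{in}$ the number of pairs $(e,j)$ with $v=t_j(e)$ and $\mathrm{out}$ the number of pairs $(e,i)$ with $v=s_i(e)$. A cospan $m\xrightarrow{f}F\xleftarrow{g}n$ is partial monogamous if $f,g$ are injective and each vertex has degree $(0,0)$ if in the images of both $f$ and $g$, $(0,1)$ if only in the image of $f$, $(1,0)$ if only in the image of $g$, and $(0,0)$ or $(1,1)$ otherwise. -}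

module Defs where

open import Data.Nat using (ℕ; zero; suc; _+_)
open import Data.Fin using (Fin; zero; suc)
open import Data.Fin.Properties using (_≟_)
open import Data.Product using (Σ; ∃; _×_; _,_)
open import Data.Sum using (_⊎_)
open import Relation.Nullary using (¬_; yes; no)
open import Relation.Binary.PropositionalEquality using (_≡_; subst; sym)
open import Function.Definitions using (Injective)

record Signature : Set₁ where
  field
    Gen  : Set
    ar   : Gen → ℕ
    coar : Gen → ℕ
open Signature public

-- Each hyperedge e carries a label (a generator); its arity/coarity
-- determine the number of ordered sources s_i (i < k) and targets t_j (j < l).
-- (Thus the edge set ⊔_{k,l} F_{k,l} is represented as a single finite set
-- with the (k,l) component read off from the label.)
record Hyp (Σ' : Signature) : Set where
  field
    V   : ℕ
    E   : ℕ
    lab : Fin E → Gen Σ'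
    src : (e : Fin E) → Fin (ar Σ' (lab e)) → Fin V
    tgt : (e : Fin E) → Fin (coar Σ' (lab e)) → Fin V
open Hyp public

record HypMor {Σ' : Signature} (F G : Hyp Σ') : Set where
  field
    mV      : Fin (V F) → Fin (V G)
    mE      : Fin (E F) → Fin (E G)
    lab-pres : ∀ e → lab G (mE e) ≡ lab F e
    src-pres : ∀ e (i : Fin (ar Σ' (lab F e))) →
      src G (mE e) (subst (λ x → Fin (ar Σ' x)) (sym (lab-pres e)) i) ≡ mV (src F e i)
    tgt-pres : ∀ e (j : Fin (coar Σ' (lab F e))) →
      tgt G (mE e) (subst (λ x → Fin (coar Σ' x)) (sym (lab-pres e)) j) ≡ mV (tgt F e j)
open HypMor public

_≈M_ : ∀ {Σ'} {F G : Hyp Σ'} → HypMor F G → HypMor F G → Set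
φ ≈M ψ = (∀ v → mV φ v ≡ mV ψ v) × (∀ e → mE φ e ≡ mE ψ e)

Factors : ∀ {Σ'} {F H K : Hyp Σ'} → HypMor H K → HypMor F H → HypMor F K → Set
Factors u φ χ = (∀ v → mV u (mV φ v) ≡ mV χ v) × (∀ e → mE u (mE φ e) ≡ mE χ e)

-- A morphism out of the discrete hypergraph n (n vertices, no hyperedges)
-- is exactly a function Fin n → vertices.  Cospan legs are given this way.

record IsPushout {Σ' : Signature} {n : ℕ} (F G : Hyp Σ')
    (g : Fin n → Fin (V F)) (f' : Fin n → Fin (V G))
    (H : Hyp Σ') (h₁ : HypMor F H) (h₂ : HypMor G H) : Set₁ where
  field
    commutes  : ∀ i → mV h₁ (g i) ≡ mV h₂ (f' i)
    universal : (K : Hyp Σ') (q₁ : HypMor F K) (q₂ : HypMor G K) →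
      (∀ i → mV q₁ (g i) ≡ mV q₂ (f' i)) →
      Σ (HypMor H K) (λ u → Factors u h₁ q₁ × Factors u h₂ q₂ ×
        ((u' : HypMor H K) → Factors u' h₁ q₁ → Factors u' h₂ q₂ → u' ≈M u))

sumFin : (n : ℕ) → (Fin n → ℕ) → ℕ
sumFin zero    f = 0
sumFin (suc n) f = f zero + sumFin n (λ i → f (suc i))

δ : ∀ {k} → Fin k → Fin k → ℕ
δ a b with a ≟ b
... | yes _ = 1
... | no  _ = 0

indeg : ∀ {Σ'} (F : Hyp Σ') → Fin (V F) → ℕ
indeg {Σ'} F v = sumFin (E F) (λ e → sumFin (coar Σ' (lab F e)) (λ j → δ (tgt F e j) v))

outdeg : ∀ {Σ'} (F : Hyp Σ') → Fin (V F) → ℕ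
outdeg {Σ'} F v = sumFin (E F) (λ e → sumFin (ar Σ' (lab F e)) (λ i → δ (src F e i) v))

degree : ∀ {Σ'} (F : Hyp Σ') → Fin (V F) → ℕ × ℕ
degree F v = indeg F v , outdeg F v

InImage : ∀ {A : Set} {k : ℕ} → (Fin k → A) → A → Set
InImage {k = k} f v = ∃ λ (i : Fin k) → f i ≡ v

PartialMonogamous : ∀ {Σ'} {m n : ℕ} (F : Hyp Σ') →
  (Fin m → Fin (V F)) → (Fin n → Fin (V F)) → Set
PartialMonogamous F f g =
  Injective _≡_ _≡_ f × Injective _≡_ _≡_ g ×
  (∀ v →
    (InImage f v → InImage g v → degree F v ≡ (0 , 0)) ×
    (InImage f v → ¬ InImage g v → degree F v ≡ (0 , 1)) ×
    (¬ InImage f v → InImage g v → degree F v ≡ (1 , 0)) ×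
    (¬ InImage f v → ¬ InImage g v → (degree F v ≡ (0 , 0)) ⊎ (degree F v ≡ (1 , 1))))

-- Edges and vertices of a pushout over a discrete interface are controlled by maps into
-- "glued coproducts" of F and G: mapping H to F + G with vertices identified as in H shows
-- that the edges of H are exactly the disjoint union of those of F and G, so every degree in
-- H is the sum of the degrees of its preimages; two-colourings of the vertices show, the
-- interface legs being injective, that a vertex of H has at most one preimage in each of F
-- and G, and preimages in both only when they come from a common interface vertex. Monogamy at a glued vertex then follows by
-- adding the two degrees, the output interface of F having degree (0 , 0) or (1 , 0) and the
-- input interface of G having degree (0 , 0) or (0 , 1).
module Submission where

open import Defs
open import Data.Nat using (ℕ; zero; suc; _+_)
open import Data.Nat.Properties using (+-0-commutativeMonoid; +-assoc; +-identityʳ)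
open import Data.Fin using (Fin; zero; suc; splitAt; _↑ˡ_; _↑ʳ_; join)
open import Data.Fin.Properties using (_≟_; any?; splitAt-↑ˡ; splitAt-↑ʳ; join-splitAt)
open import Data.Fin.Permutation using (permutation)
open import Data.Product using (∃; _×_; _,_; proj₁; proj₂)
open import Data.Sum using (_⊎_; inj₁; inj₂; [_,_])
open import Data.Empty using (⊥-elim)
open import Function.Base using (_∘_; id)
open import Function.Bundles using (_⇔_; mk⇔; Equivalence)
open import Function.Definitions using (Injective)
open import Relation.Nullary using (¬_; Dec; yes; no)
open import Relation.Nullary.Decidable using (_×-dec_)
open import Relation.Binary.PropositionalEquality hiding ([_])
import Algebra.Properties.CommutativeMonoid.Sum as CommutativeMonoidSum

open Equivalence using (to; from)

private
  variable
    S : Signature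
    F G H K : Hyp S

sumFin-cong : ∀ n {f g : Fin n → ℕ} → (∀ i → f i ≡ g i) → sumFin n f ≡ sumFin n g
sumFin-cong zero    f≗g = refl
sumFin-cong (suc n) f≗g = cong₂ _+_ (f≗g zero) (sumFin-cong n (f≗g ∘ suc))

sumFin-zero : ∀ n → sumFin n (λ _ → 0) ≡ 0
sumFin-zero zero    = refl
sumFin-zero (suc n) = sumFin-zero n

sumFin-+ : ∀ m n (f : Fin (m + n) → ℕ) →
  sumFin (m + n) f ≡ sumFin m (λ i → f (i ↑ˡ n)) + sumFin n (λ i → f (m ↑ʳ i))
sumFin-+ zero    n f = refl
sumFin-+ (suc m) n f =
  trans (cong (f zero +_) (sumFin-+ m n (f ∘ suc))) (sym (+-assoc (f zero) _ _))

sumFin-reindex : ∀ {m n} (π : Fin m → Fin n) (π⁻¹ : Fin n → Fin m) →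
  (∀ y → π (π⁻¹ y) ≡ y) → (∀ x → π⁻¹ (π x) ≡ x) →
  (f : Fin n → ℕ) → sumFin n f ≡ sumFin m (f ∘ π)
sumFin-reindex {m} {n} π π⁻¹ inverseˡ inverseʳ f =
  trans (sumFin≡sum n f)
    (trans (sum-permute f (permutation π π⁻¹ inverseˡ inverseʳ)) (sym (sumFin≡sum m (f ∘ π))))
  where
  open CommutativeMonoidSum +-0-commutativeMonoid using (sum; sum-permute)
  sumFin≡sum : ∀ k (h : Fin k → ℕ) → sumFin k h ≡ sum h
  sumFin≡sum zero    h = refl
  sumFin≡sum (suc k) h = cong (h zero +_) (sumFin≡sum k (h ∘ suc))

sumFin-subst : {A : Set} (a : A → ℕ) {x y : A} (p : x ≡ y) (f : Fin (a x) → ℕ) →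
  sumFin (a x) f ≡ sumFin (a y) (f ∘ subst (Fin ∘ a) (sym p))
sumFin-subst a refl f = refl

subst-sym-trans : {A : Set} (P : A → Set) {x y z : A} (p : x ≡ y) (q : y ≡ z) (u : P z) →
  subst P (sym (trans p q)) u ≡ subst P (sym p) (subst P (sym q) u)
subst-sym-trans P refl refl u = refl

δ-resp : ∀ {k l} {a b : Fin k} {c d : Fin l} → (a ≡ b) ⇔ (c ≡ d) → δ a b ≡ δ c d
δ-resp {a = a} {b} {c} {d} a≡b⇔c≡d with a ≟ b | c ≟ d
... | yes _   | yes _   = refl
... | yes a≡b | no  c≢d = ⊥-elim (c≢d (to a≡b⇔c≡d a≡b))
... | no  a≢b | yes c≡d = ⊥-elim (a≢b (from a≡b⇔c≡d c≡d))
... | no  _   | no  _   = refl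

δ-≢ : ∀ {k} {a b : Fin k} → a ≢ b → δ a b ≡ 0
δ-≢ {a = a} {b} a≢b with a ≟ b
... | yes a≡b = ⊥-elim (a≢b a≡b)
... | no  _   = refl

indicator : {P : Set} → Dec P → Fin 2
indicator (yes _) = zero
indicator (no  _) = suc zero

indicator-resp : {P Q : Set} (p? : Dec P) (q? : Dec Q) → P ⇔ Q → indicator p? ≡ indicator q?
indicator-resp (yes _) (yes _) P⇔Q = refl
indicator-resp (yes p) (no ¬q) P⇔Q = ⊥-elim (¬q (to P⇔Q p))
indicator-resp (no ¬p) (yes q) P⇔Q = ⊥-elim (¬p (from P⇔Q q))
indicator-resp (no _)  (no _)  P⇔Q = refl

indicator-yes : {P : Set} (p? : Dec P) → P → indicator p? ≡ zero
indicator-yes (yes _) p = refl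
indicator-yes (no ¬p) p = ⊥-elim (¬p p)

indicator-zero : {P : Set} (p? : Dec P) → indicator p? ≡ zero → P
indicator-zero (yes p) _ = p

InImage-∘⇒ : ∀ {B : Set} {k l} (φ : Fin l → B) {f : Fin k → Fin l} {w : B} →
  InImage (φ ∘ f) w → InImage φ w
InImage-∘⇒ φ {f} (i , φfi≡w) = f i , φfi≡w

InImage-∘-injective : ∀ {A B : Set} {k} {φ : A → B} {f : Fin k → A} {x : A} {w : B} →
  Injective _≡_ _≡_ φ → φ x ≡ w → InImage (φ ∘ f) w ⇔ InImage f x
InImage-∘-injective {φ = φ} φ-inj φx≡w = mk⇔
  (λ (i , φfi≡w) → i , φ-inj (trans φfi≡w (sym φx≡w)))
  (λ (i , fi≡x) → i , trans (cong φ fi≡x) φx≡w)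

empty-⇔ : {A B : Set} → ¬ A → ¬ B → A ⇔ B
empty-⇔ ¬a ¬b = mk⇔ (⊥-elim ∘ ¬a) (⊥-elim ∘ ¬b)

data Side : Set where
  source target : Side

arity : (S : Signature) → Side → Gen S → ℕ
arity S source = ar S
arity S target = coar S

endpoint : (F : Hyp S) (s : Side) (e : Fin (E F)) → Fin (arity S s (lab F e)) → Fin (V F)
endpoint F source = src F
endpoint F target = tgt F

endpoint-pres : (φ : HypMor F G) (s : Side) (e : Fin (E F)) (j : Fin (arity S s (lab F e))) →
  endpoint G s (mE φ e) (subst (Fin ∘ arity S s) (sym (lab-pres φ e)) j) ≡ mV φ (endpoint F s e j)
endpoint-pres φ source = src-pres φ
endpoint-pres φ target = tgt-pres φ

idᴴ : HypMor F F
idᴴ = record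
  { mV = id ; mE = id ; lab-pres = λ _ → refl ; src-pres = λ _ _ → refl ; tgt-pres = λ _ _ → refl }

_∘ᴴ_ : HypMor G K → HypMor F G → HypMor F K
_∘ᴴ_ {S} {G} {K} {F} ψ φ = record
  { mV = mV ψ ∘ mV φ
  ; mE = mE ψ ∘ mE φ
  ; lab-pres = λ e → trans (lab-pres ψ (mE φ e)) (lab-pres φ e)
  ; src-pres = pres source
  ; tgt-pres = pres target
  }
  where
  pres : ∀ s e (j : Fin (arity S s (lab F e))) →
    endpoint K s (mE ψ (mE φ e))
      (subst (Fin ∘ arity S s) (sym (trans (lab-pres ψ (mE φ e)) (lab-pres φ e))) j)
    ≡ mV ψ (mV φ (endpoint F s e j))
  pres s e j = begin
    endpoint K s (mE ψ (mE φ e)) (subst P (sym (trans (lab-pres ψ (mE φ e)) (lab-pres φ e))) j)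
      ≡⟨ cong (endpoint K s (mE ψ (mE φ e))) (subst-sym-trans P (lab-pres ψ (mE φ e)) (lab-pres φ e) j) ⟩
    endpoint K s (mE ψ (mE φ e)) (subst P (sym (lab-pres ψ (mE φ e))) (subst P (sym (lab-pres φ e)) j))
      ≡⟨ endpoint-pres ψ s (mE φ e) _ ⟩
    mV ψ (endpoint G s (mE φ e) (subst P (sym (lab-pres φ e)) j))
      ≡⟨ cong (mV ψ) (endpoint-pres φ s e j) ⟩
    mV ψ (mV φ (endpoint F s e j)) ∎
    where
    open ≡-Reasoning
    P = Fin ∘ arity S s

edgeSum : (F : Hyp S) → Side → Fin (E F) → (Fin (V F) → ℕ) → ℕ
edgeSum {S} F s e c = sumFin (arity S s (lab F e)) (c ∘ endpoint F s e)

-- With c = λ y → δ y v this is the in-degree (target) or out-degree (source) of v.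
endpointSum : (F : Hyp S) → Side → (Fin (V F) → ℕ) → ℕ
endpointSum F s c = sumFin (E F) (λ e → edgeSum F s e c)

edgeSum-transport : (φ : HypMor F G) (s : Side) (e : Fin (E F)) (c : Fin (V G) → ℕ) →
  edgeSum G s (mE φ e) c ≡ edgeSum F s e (c ∘ mV φ)
edgeSum-transport {S} {F} φ s e c =
  trans (sumFin-subst (arity S s) (lab-pres φ e) _)
    (sumFin-cong (arity S s (lab F e)) (λ j → cong c (endpoint-pres φ s e j)))

endpointSum-cong : (F : Hyp S) (s : Side) {c c′ : Fin (V F) → ℕ} →
  (∀ y → c y ≡ c′ y) → endpointSum F s c ≡ endpointSum F s c′
endpointSum-cong {S} F s c≗c′ =
  sumFin-cong (E F) (λ e → sumFin-cong (arity S s (lab F e)) (λ j → c≗c′ _))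

endpointSum-zero : (F : Hyp S) (s : Side) → endpointSum F s (λ _ → 0) ≡ 0
endpointSum-zero {S} F s =
  trans (sumFin-cong (E F) (λ e → sumFin-zero (arity S s (lab F e)))) (sumFin-zero (E F))

degreeAlong : (F : Hyp S) {k : ℕ} → (Fin (V F) → Fin k) → Fin k → ℕ × ℕ
degreeAlong F φ w =
  endpointSum F target (λ y → δ (φ y) w) , endpointSum F source (λ y → δ (φ y) w)

degreeAlong-injective : (F : Hyp S) {k : ℕ} {φ : Fin (V F) → Fin k} {x : Fin (V F)} {w : Fin k} →
  Injective _≡_ _≡_ φ → φ x ≡ w → degreeAlong F φ w ≡ degree F x
degreeAlong-injective F {φ = φ} {x} {w} φ-inj φx≡w = cong₂ _,_ (along target) (along source)
  where
  along : ∀ s → endpointSum F s (λ y → δ (φ y) w) ≡ endpointSum F s (λ y → δ y x)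
  along s = endpointSum-cong F s {λ y → δ (φ y) w} {λ y → δ y x} (λ y → δ-resp (mk⇔
    (λ φy≡w → φ-inj (trans φy≡w (sym φx≡w)))
    (λ y≡x → trans (cong φ y≡x) φx≡w)))

degreeAlong-∉ : (F : Hyp S) {k : ℕ} {φ : Fin (V F) → Fin k} {w : Fin k} →
  ¬ InImage φ w → degreeAlong F φ w ≡ (0 , 0)
degreeAlong-∉ F {φ = φ} {w} w∉φ = cong₂ _,_ (vanish target) (vanish source)
  where
  vanish : ∀ s → endpointSum F s (λ y → δ (φ y) w) ≡ 0
  vanish s = trans (endpointSum-cong F s {λ y → δ (φ y) w} (λ y → δ-≢ (λ φy≡w → w∉φ (y , φy≡w))))
                   (endpointSum-zero F s)

_⊕_ : ℕ × ℕ → ℕ × ℕ → ℕ × ℕ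
(a , b) ⊕ (c , d) = a + c , b + d

⊕-identityʳ : ∀ d → d ⊕ (0 , 0) ≡ d
⊕-identityʳ (a , b) = cong₂ _,_ (+-identityʳ a) (+-identityʳ b)

module Glue (F G : Hyp S) {k : ℕ} (c : Fin (V F) → Fin k) (d : Fin (V G) → Fin k) where

  label : Fin (E F) ⊎ Fin (E G) → Gen S
  label = [ lab F , lab G ]

  ends : (s : Side) (x : Fin (E F) ⊎ Fin (E G)) → Fin (arity S s (label x)) → Fin k
  ends s (inj₁ e) = c ∘ endpoint F s e
  ends s (inj₂ e) = d ∘ endpoint G s e

  hyp : Hyp S
  hyp = record
    { V = k
    ; E = E F + E G
    ; lab = λ e → label (splitAt (E F) e)
    ; src = λ e → ends source (splitAt (E F) e)
    ; tgt = λ e → ends target (splitAt (E F) e)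
    }

  ends-subst : ∀ s {x y} (x≡y : x ≡ y) j →
    ends s x (subst (Fin ∘ arity S s) (sym (cong label x≡y)) j) ≡ ends s y j
  ends-subst s refl j = refl

  inl : HypMor F hyp
  inl = record
    { mV = c
    ; mE = _↑ˡ E G
    ; lab-pres = λ e → cong label (splitAt-↑ˡ (E F) e (E G))
    ; src-pres = λ e → ends-subst source (splitAt-↑ˡ (E F) e (E G))
    ; tgt-pres = λ e → ends-subst target (splitAt-↑ˡ (E F) e (E G))
    }

  inr : HypMor G hyp
  inr = record
    { mV = d
    ; mE = E F ↑ʳ_
    ; lab-pres = λ e → cong label (splitAt-↑ʳ (E F) (E G) e)
    ; src-pres = λ e → ends-subst source (splitAt-↑ʳ (E F) (E G) e)
    ; tgt-pres = λ e → ends-subst target (splitAt-↑ʳ (E F) (E G) e)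
    }

copair : (φ : HypMor F K) (ψ : HypMor G K) → HypMor (Glue.hyp F G (mV φ) (mV ψ)) K
copair {S} {F} {K} {G} φ ψ = record
  { mV = id
  ; mE = λ e → edge (splitAt (E F) e)
  ; lab-pres = λ e → label-pres (splitAt (E F) e)
  ; src-pres = λ e → pres source (splitAt (E F) e)
  ; tgt-pres = λ e → pres target (splitAt (E F) e)
  }
  where
  open Glue F G (mV φ) (mV ψ)
  edge : Fin (E F) ⊎ Fin (E G) → Fin (E K)
  edge = [ mE φ , mE ψ ]
  label-pres : ∀ x → lab K (edge x) ≡ label x
  label-pres (inj₁ e) = lab-pres φ e
  label-pres (inj₂ e) = lab-pres ψ e
  pres : ∀ s x j → endpoint K s (edge x) (subst (Fin ∘ arity S s) (sym (label-pres x)) j) ≡ ends s x j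
  pres s (inj₁ e) = endpoint-pres φ s e
  pres s (inj₂ e) = endpoint-pres ψ s e

IsPushout-swap : ∀ {n} {g : Fin n → Fin (V F)} {f′ : Fin n → Fin (V G)}
  {h₁ : HypMor F H} {h₂ : HypMor G H} →
  IsPushout F G g f′ H h₁ h₂ → IsPushout G F f′ g H h₂ h₁
IsPushout-swap po = record
  { commutes = λ i → sym (commutes i)
  ; universal = λ K q₂ q₁ compat →
      let (u , fac₁ , fac₂ , unique) = universal K q₁ q₂ (λ i → sym (compat i))
      in u , fac₂ , fac₁ , λ u′ fac₂′ fac₁′ → unique u′ fac₁′ fac₂′
  }
  where open IsPushout po

module Pushout {n : ℕ} {F G H : Hyp S} {g : Fin n → Fin (V F)} {f′ : Fin n → Fin (V G)}
  {h₁ : HypMor F H} {h₂ : HypMor G H} (po : IsPushout F G g f′ H h₁ h₂) where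

  open IsPushout po

  module Mediator {k : ℕ} (c : Fin (V F) → Fin k) (d : Fin (V G) → Fin k)
    (compat : ∀ i → c (g i) ≡ d (f′ i)) where

    open Glue F G c d using (hyp; inl; inr)

    private
      mediation = universal hyp inl inr compat

    u : HypMor H hyp
    u = proj₁ mediation

    u-h₁ᵛ : ∀ x → mV u (mV h₁ x) ≡ c x
    u-h₁ᵛ = proj₁ (proj₁ (proj₂ mediation))

    u-h₂ᵛ : ∀ y → mV u (mV h₂ y) ≡ d y
    u-h₂ᵛ = proj₁ (proj₁ (proj₂ (proj₂ mediation)))

    u-h₁ᵉ : ∀ e → mE u (mE h₁ e) ≡ e ↑ˡ E G
    u-h₁ᵉ = proj₂ (proj₁ (proj₂ mediation))

    u-h₂ᵉ : ∀ e → mE u (mE h₂ e) ≡ E F ↑ʳ e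
    u-h₂ᵉ = proj₂ (proj₁ (proj₂ (proj₂ mediation)))

  edgeFrom : Fin (E F + E G) → Fin (E H)
  edgeFrom = mE (copair h₁ h₂)

  private
    module Edges = Mediator (mV h₁) (mV h₂) commutes

  edgeTo : Fin (E H) → Fin (E F + E G)
  edgeTo = mE Edges.u

  edgeFrom-↑ˡ : ∀ e → edgeFrom (e ↑ˡ E G) ≡ mE h₁ e
  edgeFrom-↑ˡ e = cong [ mE h₁ , mE h₂ ] (splitAt-↑ˡ (E F) e (E G))

  edgeFrom-↑ʳ : ∀ e → edgeFrom (E F ↑ʳ e) ≡ mE h₂ e
  edgeFrom-↑ʳ e = cong [ mE h₁ , mE h₂ ] (splitAt-↑ʳ (E F) (E G) e)

  edgeTo-edgeFrom : ∀ x → edgeTo (edgeFrom x) ≡ x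
  edgeTo-edgeFrom x = trans (onSum (splitAt (E F) x)) (join-splitAt (E F) (E G) x)
    where
    onSum : ∀ y → edgeTo ([ mE h₁ , mE h₂ ] y) ≡ join (E F) (E G) y
    onSum (inj₁ e) = Edges.u-h₁ᵉ e
    onSum (inj₂ e) = Edges.u-h₂ᵉ e

  -- Both copair h₁ h₂ ∘ᴴ Edges.u and idᴴ mediate (h₁ , h₂) into H, so they agree.
  edgeFrom-edgeTo : ∀ e → edgeFrom (edgeTo e) ≡ e
  edgeFrom-edgeTo e =
    trans (proj₂ (unique (copair h₁ h₂ ∘ᴴ Edges.u) mediates₁ mediates₂) e)
          (sym (proj₂ (unique idᴴ (trivial h₁) (trivial h₂)) e))
    where
    unique = proj₂ (proj₂ (proj₂ (universal H h₁ h₂ commutes)))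
    mediates₁ : Factors (copair h₁ h₂ ∘ᴴ Edges.u) h₁ h₁
    mediates₁ = Edges.u-h₁ᵛ , λ e → trans (cong edgeFrom (Edges.u-h₁ᵉ e)) (edgeFrom-↑ˡ e)
    mediates₂ : Factors (copair h₁ h₂ ∘ᴴ Edges.u) h₂ h₂
    mediates₂ = Edges.u-h₂ᵛ , λ e → trans (cong edgeFrom (Edges.u-h₂ᵉ e)) (edgeFrom-↑ʳ e)
    trivial : ∀ {X : Hyp S} (χ : HypMor X H) → Factors idᴴ χ χ
    trivial χ = (λ _ → refl) , (λ _ → refl)

  endpointSum-pushout : ∀ s (c : Fin (V H) → ℕ) →
    endpointSum H s c ≡ endpointSum F s (c ∘ mV h₁) + endpointSum G s (c ∘ mV h₂)
  endpointSum-pushout s c = begin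
    sumFin (E H) (λ e → edgeSum H s e c)
      ≡⟨ sumFin-reindex edgeFrom edgeTo edgeFrom-edgeTo edgeTo-edgeFrom _ ⟩
    sumFin (E F + E G) (λ x → edgeSum H s (edgeFrom x) c)
      ≡⟨ sumFin-+ (E F) (E G) _ ⟩
    sumFin (E F) (λ e → edgeSum H s (edgeFrom (e ↑ˡ E G)) c)
      + sumFin (E G) (λ e → edgeSum H s (edgeFrom (E F ↑ʳ e)) c)
      ≡⟨ cong₂ _+_
           (sumFin-cong (E F) (λ e → trans (cong (λ e′ → edgeSum H s e′ c) (edgeFrom-↑ˡ e))
                                            (edgeSum-transport h₁ s e c)))
           (sumFin-cong (E G) (λ e → trans (cong (λ e′ → edgeSum H s e′ c) (edgeFrom-↑ʳ e))
                                            (edgeSum-transport h₂ s e c))) ⟩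
    endpointSum F s (c ∘ mV h₁) + endpointSum G s (c ∘ mV h₂) ∎
    where open ≡-Reasoning

  degree-pushout : ∀ w → degree H w ≡ degreeAlong F (mV h₁) w ⊕ degreeAlong G (mV h₂) w
  degree-pushout w =
    cong₂ _,_ (endpointSum-pushout target (λ y → δ y w)) (endpointSum-pushout source (λ y → δ y w))

  Glued : Fin (V F) → Fin (V G) → Set
  Glued x y = ∃ λ i → g i ≡ x × f′ i ≡ y

  -- Colour a vertex of F by whether it is x₀, and a vertex of G by whether it is glued to x₀.
  module Indicator (f′-inj : Injective _≡_ _≡_ f′) (x₀ : Fin (V F)) where

    glued? : ∀ y → Dec (Glued x₀ y)
    glued? y = any? (λ i → (g i ≟ x₀) ×-dec (f′ i ≟ y))

    open Mediator (λ x → indicator (x ≟ x₀)) (λ y → indicator (glued? y))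
      (λ i → indicator-resp (g i ≟ x₀) (glued? (f′ i)) (mk⇔
        (λ gi≡x₀ → i , gi≡x₀ , refl)
        (λ (j , gj≡x₀ , f′j≡f′i) → trans (cong g (sym (f′-inj f′j≡f′i))) gj≡x₀)))
      public

    marked : mV u (mV h₁ x₀) ≡ zero
    marked = trans (u-h₁ᵛ x₀) (indicator-yes (x₀ ≟ x₀) refl)

  h₁-injective : Injective _≡_ _≡_ f′ → Injective _≡_ _≡_ (mV h₁)
  h₁-injective f′-inj {x} {x₀} h₁x≡h₁x₀ =
    indicator-zero (x ≟ x₀) (trans (sym (u-h₁ᵛ x)) (trans (cong (mV u) h₁x≡h₁x₀) marked))
    where open Indicator f′-inj x₀

  glued : Injective _≡_ _≡_ f′ → ∀ {x y} → mV h₁ x ≡ mV h₂ y → Glued x y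
  glued f′-inj {x} {y} h₁x≡h₂y =
    indicator-zero (glued? y) (trans (sym (u-h₂ᵛ y)) (trans (cong (mV u) (sym h₁x≡h₂y)) marked))
    where open Indicator f′-inj x

  interface-image : ∀ {x} → InImage g x → InImage (mV h₂) (mV h₁ x)
  interface-image (i , gi≡x) = f′ i , trans (sym (commutes i)) (cong (mV h₁) gi≡x)

MonogamyAt : Set → Set → ℕ × ℕ → Set
MonogamyAt P Q d =
  (P → Q → d ≡ (0 , 0)) ×
  (P → ¬ Q → d ≡ (0 , 1)) ×
  (¬ P → Q → d ≡ (1 , 0)) ×
  (¬ P → ¬ Q → (d ≡ (0 , 0)) ⊎ (d ≡ (1 , 1)))

MonogamyAt-resp : {P P′ Q Q′ : Set} {d d′ : ℕ × ℕ} →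
  P′ ⇔ P → Q′ ⇔ Q → d′ ≡ d → MonogamyAt P Q d → MonogamyAt P′ Q′ d′
MonogamyAt-resp P′⇔P Q′⇔Q refl (both , left , right , neither) =
  (λ p q → both (to P′⇔P p) (to Q′⇔Q q)) ,
  (λ p ¬q → left (to P′⇔P p) (¬q ∘ from Q′⇔Q)) ,
  (λ ¬p q → right (¬p ∘ from P′⇔P) (to Q′⇔Q q)) ,
  (λ ¬p ¬q → neither (¬p ∘ from P′⇔P) (¬q ∘ from Q′⇔Q))

MonogamyAt-isolated : {P Q : Set} {d : ℕ × ℕ} → ¬ P → ¬ Q → d ≡ (0 , 0) → MonogamyAt P Q d
MonogamyAt-isolated ¬p ¬q refl =
  (λ p _ → ⊥-elim (¬p p)) , (λ p _ → ⊥-elim (¬p p)) , (λ _ q → ⊥-elim (¬q q)) , (λ _ _ → inj₁ refl)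

-- An output interface vertex of the first cospan (R holds) glued to an input interface vertex
-- of the second (R′ holds).
MonogamyAt-compose : {P Q R R′ : Set} {d₁ d₂ : ℕ × ℕ} →
  MonogamyAt P R d₁ → R → MonogamyAt R′ Q d₂ → R′ → MonogamyAt P Q (d₁ ⊕ d₂)
MonogamyAt-compose (pr , _ , ¬pr , _) r (rq , r¬q , _ , _) r′ =
  (λ p q → cong₂ _⊕_ (pr p r) (rq r′ q)) ,
  (λ p ¬q → cong₂ _⊕_ (pr p r) (r¬q r′ ¬q)) ,
  (λ ¬p q → cong₂ _⊕_ (¬pr ¬p r) (rq r′ q)) ,
  (λ ¬p ¬q → inj₂ (cong₂ _⊕_ (¬pr ¬p r) (r¬q r′ ¬q)))

module MonogamousPushout {m n p : ℕ} {F G H : Hyp S}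
  {f : Fin m → Fin (V F)} {g : Fin n → Fin (V F)}
  {f′ : Fin n → Fin (V G)} {g′ : Fin p → Fin (V G)}
  {h₁ : HypMor F H} {h₂ : HypMor G H} (po : IsPushout F G g f′ H h₁ h₂)
  (g-inj : Injective _≡_ _≡_ g) (f′-inj : Injective _≡_ _≡_ f′)
  (monogamyF : ∀ x → MonogamyAt (InImage f x) (InImage g x) (degree F x))
  (monogamyG : ∀ y → MonogamyAt (InImage f′ y) (InImage g′ y) (degree G y)) where

  open Pushout po
  private
    module Swapped = Pushout (IsPushout-swap po)

  h₂-injective : Injective _≡_ _≡_ (mV h₂)
  h₂-injective = Swapped.h₁-injective g-inj

  MonogamyH : Fin (V H) → Set
  MonogamyH w = MonogamyAt (InImage (mV h₁ ∘ f) w) (InImage (mV h₂ ∘ g′) w) (degree H w)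

  from-F : ∀ {x w} → mV h₁ x ≡ w → ¬ InImage (mV h₂) w → MonogamyH w
  from-F {x} {w} refl w∉h₂ = MonogamyAt-resp
    (InImage-∘-injective (h₁-injective f′-inj) refl)
    (empty-⇔ (w∉h₂ ∘ InImage-∘⇒ (mV h₂)) (w∉h₂ ∘ interface-image))
    (begin
      degree H w                                              ≡⟨ degree-pushout w ⟩
      degreeAlong F (mV h₁) w ⊕ degreeAlong G (mV h₂) w
        ≡⟨ cong₂ _⊕_ (degreeAlong-injective F (h₁-injective f′-inj) refl) (degreeAlong-∉ G w∉h₂) ⟩
      degree F x ⊕ (0 , 0)                                    ≡⟨ ⊕-identityʳ (degree F x) ⟩
      degree F x                                              ∎)
    (monogamyF x)
    where open ≡-Reasoning

  from-G : ∀ {y w} → mV h₂ y ≡ w → ¬ InImage (mV h₁) w → MonogamyH w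
  from-G {y} {w} refl w∉h₁ = MonogamyAt-resp
    (empty-⇔ (w∉h₁ ∘ InImage-∘⇒ (mV h₁)) (w∉h₁ ∘ Swapped.interface-image))
    (InImage-∘-injective h₂-injective refl)
    (trans (degree-pushout w)
      (cong₂ _⊕_ (degreeAlong-∉ F w∉h₁) (degreeAlong-injective G h₂-injective refl)))
    (monogamyG y)

  from-both : ∀ {x y w} → mV h₁ x ≡ w → mV h₂ y ≡ w → MonogamyH w
  from-both {x} {y} {w} refl h₂y≡w with glued f′-inj (sym h₂y≡w)
  ... | i , gi≡x , f′i≡y = MonogamyAt-resp
    (InImage-∘-injective (h₁-injective f′-inj) refl)
    (InImage-∘-injective h₂-injective h₂y≡w)
    (trans (degree-pushout w)
      (cong₂ _⊕_ (degreeAlong-injective F (h₁-injective f′-inj) refl)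
                 (degreeAlong-injective G h₂-injective h₂y≡w)))
    (MonogamyAt-compose (monogamyF x) (i , gi≡x) (monogamyG y) (i , f′i≡y))

  from-neither : ∀ {w} → ¬ InImage (mV h₁) w → ¬ InImage (mV h₂) w → MonogamyH w
  from-neither {w} w∉h₁ w∉h₂ = MonogamyAt-isolated
    (w∉h₁ ∘ InImage-∘⇒ (mV h₁))
    (w∉h₂ ∘ InImage-∘⇒ (mV h₂))
    (trans (degree-pushout w) (cong₂ _⊕_ (degreeAlong-∉ F w∉h₁) (degreeAlong-∉ G w∉h₂)))

  monogamyH : ∀ w → MonogamyH w
  monogamyH w with any? (λ x → mV h₁ x ≟ w) | any? (λ y → mV h₂ y ≟ w)
  ... | yes (x , h₁x≡w) | yes (y , h₂y≡w) = from-both h₁x≡w h₂y≡w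
  ... | yes (x , h₁x≡w) | no  w∉h₂        = from-F h₁x≡w w∉h₂
  ... | no  w∉h₁        | yes (y , h₂y≡w) = from-G h₂y≡w w∉h₁
  ... | no  w∉h₁        | no  w∉h₂        = from-neither w∉h₁ w∉h₂

lemma3p26 : (Σ' : Signature) {m n p : ℕ}
    (F G : Hyp Σ')
    (f : Fin m → Fin (V F)) (g : Fin n → Fin (V F))
    (f' : Fin n → Fin (V G)) (g' : Fin p → Fin (V G)) →
    PartialMonogamous F f g →
    PartialMonogamous G f' g' →
    (H : Hyp Σ') (h₁ : HypMor F H) (h₂ : HypMor G H) →
    IsPushout F G g f' H h₁ h₂ →
    PartialMonogamous H (λ i → mV h₁ (f i)) (λ k → mV h₂ (g' k))
lemma3p26 _ F G f g f' g' (f-inj , g-inj , monogamyF) (f'-inj , g'-inj , monogamyG) H h₁ h₂ po =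
  (λ eq → f-inj (h₁-injective f'-inj eq)) ,
  (λ eq → g'-inj (h₂-injective eq)) ,
  monogamyH
  where
  open Pushout po using (h₁-injective)
  open MonogamousPushout {f = f} {g′ = g'} po g-inj f'-inj monogamyF monogamyG
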